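{- Consider an execution of the procedure \texttt{search}$(\mathcal{G},T)$ described below. Whenever a region $Z$ with strategy $\sigma$ is computed (for the current subgame $\mathcal{G}'$, top priority $p$ and player $\alpha\equiv p\pmod 2$), every play in $\mathcal{G}'$ that is consistent with $\sigma$ and stays in $Z$ forever is won by player $\alpha$.
   Context: Parity games: $\mathcal{G}=(V_0,V_1,E,\mathsf{pr})$ with finite $V=V_0\cup V_1$ (Even owns $V_0$, Odd owns $V_1$), left-total $E\subseteq V\times V$, $\mathsf{pr}:V\to\{0,\dots,d\}$; plays are infinite paths, won by Even iff the highest priority seen infinitely often is even; $\overline{\alpha}$ is the opponent of $\alpha$; strategies are partial functions $\sigma\subseteq E$ on $V_\alpha$. A $p$-tangle is a nonempty $U\subseteq V$ with $p=\max\mathsf{pr}(U)$ and a witness strategy $\sigma_T(U):U\cap V_\alpha\to U$ of player $\alpha\equiv p\pmod 2$ such that $(U, E\cap(\sigma_T(U)\cup((U\cap V_{\overline\alpha})\times U)))$ is strongly connected and all its cycles have highest priority of parity $\alpha$. For a tangle $t$ of $\alpha$, $E_T(t)=\{v\in V\setminus t\mid \exists u\in t\cap V_{\overline\alpha}, (u,v)\in E\}$ (edges taken in the full game $\mathcal{G}$). For $U\subseteq V$, $\mathcal{G}\cap U$ is the subgame induced by $U$, and for a set of tangles $T$, $T\cap U=\{t\in T\mid t\subseteq U\}$. Tangle attractor: for a game $\mathcal{G}'$ with vertices $V'$, a set $T'$ of tangles and $A\subseteq V'$, $\mathit{TAttr}^{\mathcal{G}',T'}_\alpha(A)$ is the least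 fixed point $Z$ of $Z=A\cup\{v\in V'_\alpha\mid E(v)\cap Z\ne\emptyset\}\cup\{v\in V'_{\overline\alpha}\mid E(v)\subseteq Z\}\cup\{v\in t\mid t\in T',\ \mathsf{pr}(t)\equiv\alpha \pmod 2,\ E_T(t)\neq\emptyset,\ E_T(t)\subseteq Z\}$ (with edges in $\mathcal{G}'$). It also yields a strategy $\sigma$ of $\alpha$: when an $\alpha$-vertex is added because of a successor in $Z$, $\sigma$ picks that successor; $\alpha$-vertices of $A$ get a successor in $Z$ when the backward search finds one; when the vertices of a tangle $t$ are added (tangles processed one at a time), $\sigma$ is extended by $\{(u,v)\in\sigma_T(t)\mid u\notin\mathrm{dom}(\sigma)\}$. \texttt{extract-tangles}$(Z,\sigma)$: compute the greatest $X\subseteq Z$ with $X=Z\cap(\{v\in V_{\overline\alpha}\mid E'(v)\subseteq X\}\cup\{v\in V_\alpha\mid\sigma(v)\in X\})$, where $E'$ are edges of the current subgame $\mathcal{G}'$; return the set of nontrivial bottom strongly connected components of the graph on $X$ whose edges are all $E'$-edges from $\overline\alpha$-vertices and the $\sigma$-edges from $\alpha$-vertices, each with witness strategy $\sigma$ restricted to it. \texttt{search}$(\mathcal{G},T)$: repeat forever: set the region function $\mathsf{r}:=\emptyset$ (a partial map $V\to\{0,\dots,d\}$) and $Y:=\emptyset$; while $V\setminus\mathrm{dom}(\mathsf{r})\ne\emptyset$: let $\mathcal{G}'=\mathcal{G}\cap(V\setminus\mathrm{dom}(\mathsf{r}))$, $T'=T\cap(V\setminus\mathrm{dom}(\mathsf{r}))$,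 $p$ the highest priority in $\mathcal{G}'$, $\alpha=p\bmod 2$; compute $(Z,\sigma)=\mathit{TAttr}^{\mathcal{G}',T'}_\alpha(\{v\in\mathcal{G}'\mid\mathsf{pr}(v)=p\})$ (the region of priority $p$); $A:=$\texttt{extract-tangles}$(Z,\sigma)$; if some $t\in A$ has $E_T(t)=\emptyset$, return $(T\cup Y,t)$; otherwise set $\mathsf{r}(v):=p$ for all $v\in Z$ and $Y:=Y\cup A$. After the while loop, set $T:=T\cup Y$. -}

module Defs where

open import Data.Nat using (ℕ; zero; suc; _≤_; _⊔_)
open import Data.Fin using (Fin; _≟_)
open import Data.Fin.Subset using (Subset; _∈_; _∉_; _⊆_; _∪_; ⁅_⁆; ∁; ⊤; ⊥; Nonempty; Empty)
open import Data.Vec using (lookup)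
open import Data.Bool using (if_then_else_)
open import Data.Maybe using (Maybe; just; nothing; _<∣>_)
open import Data.List using (List; []; _∷_; _++_; map; foldr)
import Data.List.Membership.Propositional as L
open import Data.Product using (Σ; ∃; _×_; _,_)
open import Data.Sum using (_⊎_)
open import Relation.Nullary using (¬_; does)
open import Relation.Binary.PropositionalEquality using (_≡_)
open import Relation.Binary.Construct.Closure.ReflexiveTransitive using (Star)

data Player : Set where
  even odd : Player

opp : Player → Player
opp even = odd
opp odd  = even

parity : ℕ → Player
parity zero    = even
parity (suc k) = opp (parity k)

record Game (n : ℕ) : Set₁ where
  field
    owner : Fin n → Player          -- owner v ≡ even  iff  v ∈ V₀
    E     : Fin n → Fin n → Set
    pr    : Fin n → ℕ
    total : ∀ v → ∃ λ w → E v w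

Strategy : ℕ → Set
Strategy n = Fin n → Maybe (Fin n)

emptyStrat : ∀ {n} → Strategy n
emptyStrat _ = nothing

update : ∀ {n} → Strategy n → Fin n → Fin n → Strategy n
update σ v w u = if does (u ≟ v) then just w else σ u

extend : ∀ {n} → Strategy n → Strategy n → Strategy n
extend σ τ u = σ u <∣> τ u

restrict : ∀ {n} → Strategy n → Subset n → Strategy n
restrict σ C v = if lookup C v then σ v else nothing

record Tangle (n : ℕ) : Set where
  constructor mkTangle
  field
    carrier : Subset n
    strat   : Strategy n
open Tangle public

-- walks recording the visited vertices (all but the final one); length ≥ 1
data Walk {n : ℕ} (R : Fin n → Fin n → Set) : Fin n → Fin n → List (Fin n) → Set where
  edge : ∀ {u w} → R u w → Walk R u w (u ∷ [])
  step : ∀ {u v w vs} → R u v → Walk R v w vs → Walk R u w (u ∷ vs)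

maxList : List ℕ → ℕ
maxList = foldr _⊔_ 0

module _ {n : ℕ} (G : Game n) where
  open Game G

  IsMaxPr : Subset n → ℕ → Set
  IsMaxPr U p = (∃ λ v → v ∈ U × pr v ≡ p) × (∀ v → v ∈ U → pr v ≤ p)

  IsTop : Subset n → ℕ → Subset n → Set
  IsTop U p A = ∀ v → (v ∈ A → v ∈ U × pr v ≡ p) × (v ∈ U × pr v ≡ p → v ∈ A)

  IsWitness : Subset n → Player → Strategy n → Set
  IsWitness U α σ =
    (∀ v → v ∈ U → owner v ≡ α → ∃ λ w → σ v ≡ just w × w ∈ U × E v w) ×
    (∀ v w → σ v ≡ just w → v ∈ U × owner v ≡ α)

  TGraph : Subset n → Player → Strategy n → Fin n → Fin n → Set
  TGraph U α σ u w = u ∈ U × w ∈ U × E u w × (owner u ≡ α → σ u ≡ just w)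

  IsTangle : Tangle n → Set
  IsTangle t = Σ ℕ λ p →
      IsMaxPr (carrier t) p
    × IsWitness (carrier t) (parity p) (strat t)
    × (∀ u w → u ∈ carrier t → w ∈ carrier t →
         Star (TGraph (carrier t) (parity p) (strat t)) u w)
    × (∀ u vs → Walk (TGraph (carrier t) (parity p) (strat t)) u u vs →
         parity (maxList (map pr vs)) ≡ parity p)

  TangleOf : Tangle n → Player → Set
  TangleOf t α = Σ ℕ λ p → IsMaxPr (carrier t) p × parity p ≡ α

  ETEdge : Subset n → Tangle n → Player → Fin n → Set
  ETEdge U t α v = v ∈ U × v ∉ carrier t ×
    (∃ λ u → u ∈ carrier t × owner u ≡ opp α × E u v)

  -- Tangle attractor TAttr^{G ∩ U, T ∩ U}_α (A) with its strategy,
  -- as the runs of the (nondeterministic) backward search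

  AttrState : Set
  AttrState = Subset n × Strategy n

  data AttrStep (U : Subset n) (α : Player) (T : List (Tangle n)) (A : Subset n)
       : AttrState → AttrState → Set where
    attrα : ∀ {Z σ v w} → v ∈ U → v ∉ Z → owner v ≡ α → w ∈ U → w ∈ Z → E v w →
            AttrStep U α T A (Z , σ) (Z ∪ ⁅ v ⁆ , update σ v w)
    attrᾱ : ∀ {Z σ v} → v ∈ U → v ∉ Z → owner v ≡ opp α →
            (∀ w → w ∈ U → E v w → w ∈ Z) →
            AttrStep U α T A (Z , σ) (Z ∪ ⁅ v ⁆ , σ)
    attrA : ∀ {Z σ v w} → v ∈ A → owner v ≡ α → σ v ≡ nothing → w ∈ U → w ∈ Z → E v w →
            AttrStep U α T A (Z , σ) (Z , update σ v w)
    attrT : ∀ {Z σ} t → t L.∈ T → carrier t ⊆ U → TangleOf t α →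
            (∃ λ v → ETEdge U t α v) → (∀ v → ETEdge U t α v → v ∈ Z) →
            ¬ (carrier t ⊆ Z) →
            AttrStep U α T A (Z , σ) (Z ∪ carrier t , extend σ (strat t))

  AttrFinal : Subset n → Player → List (Tangle n) → Subset n → AttrState → Set
  AttrFinal U α T A (Z , σ) =
      (∀ v w → v ∈ U → v ∉ Z → owner v ≡ α → w ∈ U → E v w → w ∉ Z)
    × (∀ v → v ∈ U → v ∉ Z → owner v ≡ opp α → ¬ (∀ w → w ∈ U → E v w → w ∈ Z))
    × (∀ t → t L.∈ T → carrier t ⊆ U → TangleOf t α →
         (∃ λ v → ETEdge U t α v) → (∀ v → ETEdge U t α v → v ∈ Z) → carrier t ⊆ Z)
    × (∀ v w → v ∈ A → owner v ≡ α → w ∈ U → w ∈ Z → E v w → ∃ λ w' → σ v ≡ just w')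

  AttrComp : Subset n → Player → List (Tangle n) → Subset n → Subset n → Strategy n → Set
  AttrComp U α T A Z σ =
    Star (AttrStep U α T A) (A , emptyStrat) (Z , σ) × AttrFinal U α T A (Z , σ)

  XCond : Subset n → Player → Subset n → Strategy n → Subset n → Fin n → Set
  XCond U α Z σ X v = v ∈ Z ×
    ((owner v ≡ opp α × (∀ w → w ∈ U → E v w → w ∈ X)) ⊎
     (owner v ≡ α × (∃ λ w → σ v ≡ just w × w ∈ X)))

  IsXFix : Subset n → Player → Subset n → Strategy n → Subset n → Set
  IsXFix U α Z σ X = ∀ v → (v ∈ X → XCond U α Z σ X v) × (XCond U α Z σ X v → v ∈ X)

  IsGreatestX : Subset n → Player → Subset n → Strategy n → Subset n → Set
  IsGreatestX U α Z σ X = IsXFix U α Z σ X × (∀ X' → IsXFix U α Z σ X' → X' ⊆ X)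

  XGraph : Subset n → Player → Strategy n → Subset n → Fin n → Fin n → Set
  XGraph U α σ X u w = u ∈ X × w ∈ X ×
    ((owner u ≡ opp α × w ∈ U × E u w) ⊎ (owner u ≡ α × σ u ≡ just w))

  IsNBSCC : Subset n → Player → Strategy n → Subset n → Subset n → Set
  IsNBSCC U α σ X C = C ⊆ X
    × (∀ u w → u ∈ C → w ∈ C → Star (XGraph U α σ X) u w)
    × (∀ u w → u ∈ C → Star (XGraph U α σ X) u w → w ∈ C)
    × (∃ λ u → ∃ λ w → u ∈ C × w ∈ C × XGraph U α σ X u w)

  ExtractSpec : Subset n → Player → Subset n → Strategy n → List (Tangle n) → Set
  ExtractSpec U α Z σ As = Σ (Subset n) λ X → IsGreatestX U α Z σ X
    × (∀ t → t L.∈ As → IsNBSCC U α σ X (carrier t) × (∀ v → strat t v ≡ restrict σ (carrier t) v))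
    × (∀ C → IsNBSCC U α σ X C → ∃ λ t → t L.∈ As × carrier t ≡ C)

  -- search (G , T): configurations (T , dom r , Y) and the steps that
  -- continue the execution (a returning iteration ends the execution)

  Config : Set
  Config = List (Tangle n) × Subset n × List (Tangle n)

  data SearchStep : Config → Config → Set where
    inner : ∀ {T D Y p A Z σ As} →
            Nonempty (∁ D) → IsMaxPr (∁ D) p → IsTop (∁ D) p A →
            AttrComp (∁ D) (parity p) T A Z σ →
            ExtractSpec (∁ D) (parity p) Z σ As →
            (∀ t → t L.∈ As → ∃ λ v → ETEdge ⊤ t (parity p) v) →
            SearchStep (T , D , Y) (T , D ∪ Z , Y ++ As)
    outer : ∀ {T D Y} → Empty (∁ D) → SearchStep (T , D , Y) (T ++ Y , ⊥ , [])

  IsPlay : Subset n → (ℕ → Fin n) → Set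
  IsPlay U π = ∀ i → π i ∈ U × E (π i) (π (suc i))

  Consistent : Strategy n → (ℕ → Fin n) → Set
  Consistent σ π = ∀ i w → σ (π i) ≡ just w → π (suc i) ≡ w

  InfOften : (ℕ → Fin n) → ℕ → Set
  InfOften π m = ∀ i → ∃ λ j → i ≤ j × pr (π j) ≡ m

  EventuallyBelow : (ℕ → Fin n) → ℕ → Set
  EventuallyBelow π m = ∃ λ i → ∀ j → i ≤ j → pr (π j) ≤ m

  -- α wins π: the highest priority seen infinitely often has parity α
  WonBy : Player → (ℕ → Fin n) → Set
  WonBy α π = ∀ m → InfOften π m → EventuallyBelow π m → parity m ≡ α

-- Building the region, the attractor maintains an invariant on (Z, σ): σ is a strategy of α
-- on Z, every σ-consistent move from Z ∖ A stays in Z, and every σ-consistent cycle in Z that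
-- avoids A has a top priority of parity α. Attracting a single vertex preserves it, since a
-- cycle through the new vertex would have to leave the old region; attracting a tangle preserves
-- it, since a cycle either meets the old region, and then stays there, or lies inside the tangle,
-- whose cycles are won by α. Cycles through A contain the top priority p, so every σ-consistent
-- cycle in Z is won by α. A play staying in Z is then won by α: once higher priorities have
-- stopped, it repeats a vertex of its highest recurring priority, closing such a cycle.
-- The tangles the attractor uses are either given or were extracted from earlier regions, where
-- the same cycle property shows that they are won by their player.
module Submission where

open import Defs
open import Function using (id; _∘_)
open import Data.Nat using (ℕ; zero; suc; _+_; _≤_; _<_; z≤n; s≤s)
open import Data.Nat.Properties
  using (≤-antisym; ≤-trans; ≤-reflexive; <-trans; ⊔-lub; m≤n⇒m≤n⊔o; m≤n⇒m≤o⊔n;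
         m≤n⇒m<n∨m≡n; m≤n⇒∃[o]m+o≡n; m≤n+m; n<1+n; <⇒≤; +-comm)
open import Data.Fin using (Fin; toℕ; _≟_)
open import Data.Fin.Properties using (pigeonhole)
open import Data.Fin.Subset using (Subset; _∈_; _∉_; _⊆_; _∪_; ⁅_⁆; ∁; ⊥; Nonempty)
open import Data.Fin.Subset.Properties using (x∈p∪q⁻; p⊆p∪q; q⊆p∪q; x∈⁅x⁆; x∈⁅y⁆⇒x≡y; _∈?_)
open import Data.Vec using (lookup)
open import Data.Vec.Properties using ([]=⇒lookup; lookup⇒[]=)
open import Data.Bool using (true; false)
open import Data.Maybe using (just; nothing)
open import Data.Maybe.Properties using (just-injective)
open import Data.List using (List; []; _∷_; map; applyUpTo)
open import Data.List.Relation.Unary.All using (All; []; _∷_)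
import Data.List.Relation.Unary.All as All
open import Data.List.Relation.Unary.All.Properties
  using (¬Any⇒All¬; applyUpTo⁺₂; ++⁺) renaming (map⁺ to All-map⁺)
open import Data.List.Relation.Unary.Any using (Any; here; there; any?)
import Data.List.Relation.Unary.Any as Any
open import Data.List.Relation.Unary.Any.Properties using () renaming (map⁺ to Any-map⁺)
import Data.List.Membership.Propositional as L
open import Data.Product using (∃; ∃₂; _×_; _,_; proj₁; proj₂)
open import Data.Sum using (_⊎_; inj₁; inj₂)
open import Data.Empty using (⊥-elim)
open import Relation.Nullary using (yes; no; contradiction)
open import Relation.Binary.PropositionalEquality using (_≡_; _≢_; refl; sym; trans; cong; subst)
open import Relation.Binary.Construct.Closure.ReflexiveTransitive using (Star; ε; _◅_; fold)

opp-≢ : ∀ α → opp α ≢ α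
opp-≢ even ()
opp-≢ odd ()

≡-or-opp : ∀ β α → β ≡ α ⊎ β ≡ opp α
≡-or-opp even even = inj₁ refl
≡-or-opp even odd  = inj₂ refl
≡-or-opp odd  even = inj₂ refl
≡-or-opp odd  odd  = inj₁ refl

maxList-≤ : ∀ {m ns} → All (_≤ m) ns → maxList ns ≤ m
maxList-≤ []       = z≤n
maxList-≤ (p ∷ ps) = ⊔-lub p (maxList-≤ ps)

≤-maxList : ∀ {m ns} → Any (m ≤_) ns → m ≤ maxList ns
≤-maxList {ns = k ∷ ns} (here p)  = m≤n⇒m≤n⊔o (maxList ns) p
≤-maxList {ns = k ∷ ns} (there a) = m≤n⇒m≤o⊔n k (≤-maxList a)

maxList-map-≡ : ∀ {A : Set} (f : A → ℕ) {m vs} →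
                All (λ v → f v ≤ m) vs → Any (λ v → f v ≡ m) vs → maxList (map f vs) ≡ m
maxList-map-≡ f bounded attained =
  ≤-antisym (maxList-≤ (All-map⁺ bounded))
            (≤-maxList (Any-map⁺ (Any.map (λ eq → ≤-reflexive (sym eq)) attained)))

increasing⇒monotone : ∀ (f : ℕ → ℕ) → (∀ r → f r < f (suc r)) → ∀ {r s} → r < s → f r < f s
increasing⇒monotone f inc {r} {suc s} (s≤s r≤s) with m≤n⇒m<n∨m≡n r≤s
... | inj₁ r<s  = <-trans (increasing⇒monotone f inc r<s) (inc s)
... | inj₂ refl = inc r

module _ {n : ℕ} where

  ∪-⊆ : {p q r : Subset n} → p ⊆ r → q ⊆ r → p ∪ q ⊆ r
  ∪-⊆ {p} {q} p⊆r q⊆r x∈ with x∈p∪q⁻ p q x∈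
  ... | inj₁ x∈p = p⊆r x∈p
  ... | inj₂ x∈q = q⊆r x∈q

  ⁅⁆-⊆ : ∀ {v} {r : Subset n} → v ∈ r → ⁅ v ⁆ ⊆ r
  ⁅⁆-⊆ {v} v∈r x∈ = subst (_∈ _) (sym (x∈⁅y⁆⇒x≡y v x∈)) v∈r

  ∈-∪-∉ : ∀ {x} {p q : Subset n} → x ∈ p ∪ q → x ∉ p → x ∈ q
  ∈-∪-∉ {p = p} {q} x∈ x∉p with x∈p∪q⁻ p q x∈
  ... | inj₁ x∈p = contradiction x∈p x∉p
  ... | inj₂ x∈q = x∈q

  _⊑_ : Strategy n → Strategy n → Set
  σ ⊑ σ′ = ∀ {v w} → σ v ≡ just w → σ′ v ≡ just w

  update-≡ : ∀ (σ : Strategy n) v w → update σ v w v ≡ just w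
  update-≡ σ v w with v ≟ v
  ... | yes _ = refl
  ... | no v≢v = contradiction refl v≢v

  update-just : ∀ (σ : Strategy n) v w {u x} → update σ v w u ≡ just x →
                (u ≡ v × w ≡ x) ⊎ σ u ≡ just x
  update-just σ v w {u} eq with u ≟ v
  ... | yes u≡v = inj₁ (u≡v , just-injective eq)
  ... | no _    = inj₂ eq

  update-⊒ : ∀ (σ : Strategy n) {v} w → σ v ≡ nothing → σ ⊑ update σ v w
  update-⊒ σ {v} w σv≡nothing {u} eq with u ≟ v
  ... | yes refl = contradiction (trans (sym σv≡nothing) eq) λ ()
  ... | no _     = eq

  extend-⊒ : ∀ (σ τ : Strategy n) → σ ⊑ extend σ τ
  extend-⊒ σ τ eq rewrite eq = refl

  extend-nothing : ∀ (σ τ : Strategy n) {u} → σ u ≡ nothing → extend σ τ u ≡ τ u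
  extend-nothing σ τ eq rewrite eq = refl

  extend-just : ∀ (σ τ : Strategy n) {u w} → extend σ τ u ≡ just w → σ u ≡ just w ⊎ τ u ≡ just w
  extend-just σ τ {u} eq with σ u
  ... | just _  = inj₁ eq
  ... | nothing = inj₂ eq

  restrict-∈ : ∀ (σ : Strategy n) {C v} → v ∈ C → restrict σ C v ≡ σ v
  restrict-∈ σ {C} {v} v∈C rewrite []=⇒lookup v∈C = refl

  restrict-just : ∀ (σ : Strategy n) C {v w} → restrict σ C v ≡ just w → v ∈ C × σ v ≡ just w
  restrict-just σ C {v} eq with lookup C v in lookup≡
  ... | true  = lookup⇒[]= v C lookup≡ , eq
  ... | false = contradiction eq λ ()

module _ {n : ℕ} {R : Fin n → Fin n → Set} where

  Walk-map : ∀ {R′ : Fin n → Fin n → Set} → (∀ {a b} → R a b → R′ a b) →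
             ∀ {x y vs} → Walk R x y vs → Walk R′ x y vs
  Walk-map f (edge r)   = edge (f r)
  Walk-map f (step r w) = step (f r) (Walk-map f w)

  Walk-head : ∀ {P : Fin n → Set} {x y vs} → Walk R x y vs → All P vs → P x
  Walk-head (edge _)   (px ∷ _) = px
  Walk-head (step _ _) (px ∷ _) = px

  Walk-restrict : ∀ {R′ : Fin n → Fin n → Set} {P : Fin n → Set} →
                  (∀ {a b} → R a b → P a → P b → R′ a b) →
                  ∀ {x y vs} → Walk R x y vs → All P vs → P y → Walk R′ x y vs
  Walk-restrict f (edge r)   (pa ∷ [])  py = edge (f r pa py)
  Walk-restrict f (step r w) (pa ∷ ps) py = step (f r pa (Walk-head w ps)) (Walk-restrict f w ps py)

  Walk-sources : ∀ {P : Fin n → Set} → (∀ {a b} → R a b → P a) →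
                 ∀ {x y vs} → Walk R x y vs → All P vs
  Walk-sources f (edge r)   = f r ∷ []
  Walk-sources f (step r w) = f r ∷ Walk-sources f w

  Walk-reachable : ∀ {x y vs} → Walk R x y vs → All (Star R x) vs
  Walk-reachable (edge _)   = ε ∷ []
  Walk-reachable (step r w) = ε ∷ All.map (r ◅_) (Walk-reachable w)

  Walk-via : ∀ {x a b y} → Star R x a → R a b → Star R b y → ∃ λ vs → Walk R x y (x ∷ vs)
  Walk-via ε        r ε         = _ , edge r
  Walk-via ε        r (r′ ◅ rs) = _ , step r (proj₂ (Walk-via ε r′ rs))
  Walk-via (r′ ◅ rs) r s        = _ , step r′ (proj₂ (Walk-via rs r s))

  module _ {P Q : Fin n → Set} where

    Walk-end : (∀ {a b} → R a b → P a → Q b) → ∀ {x y vs} → Walk R x y vs → All P vs → Q y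
    Walk-end f (edge r)   (pa ∷ []) = f r pa
    Walk-end f (step _ w) (_ ∷ ps)  = Walk-end f w ps

    Walk-forward : (∀ {a b} → R a b → P a → Q a → Q b) →
                   ∀ {x y vs} → Walk R x y vs → All P vs → Q x → Q y
    Walk-forward f (edge r)   (pa ∷ [])  qa = f r pa qa
    Walk-forward f (step r w) (pa ∷ ps) qa = Walk-forward f w ps (f r pa qa)

    Walk-propagate : (∀ {a b} → R a b → P a → Q a → Q b) →
                     ∀ {x y vs} → Walk R x y vs → All P vs → Q x → All Q vs
    Walk-propagate f (edge _)   _         qa = qa ∷ []
    Walk-propagate f (step r w) (pa ∷ ps) qa = qa ∷ Walk-propagate f w ps (f r pa qa)

    Walk-forward-any : (∀ {a b} → R a b → P a → Q a → Q b) →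
                       ∀ {x y vs} → Walk R x y vs → All P vs → Any Q vs → Q y
    Walk-forward-any f w@(edge _)   ps       (here qa) = Walk-forward f w ps qa
    Walk-forward-any f w@(step _ _) ps       (here qa) = Walk-forward f w ps qa
    Walk-forward-any f (step _ w) (_ ∷ ps) (there q) = Walk-forward-any f w ps q

    cycle-all : (∀ {a b} → R a b → P a → Q b) → ∀ {u vs} → Walk R u u vs → All P vs → All Q vs
    cycle-all f w ps = Walk-propagate (λ r pa _ → f r pa) w ps (Walk-end f w ps)

    cycle-spread : (∀ {a b} → R a b → P a → Q a → Q b) →
                   ∀ {u vs} → Walk R u u vs → All P vs → Any Q vs → All Q vs
    cycle-spread f w ps q = Walk-propagate f w ps (Walk-forward-any f w ps q)

prefix-walk : ∀ {n} {R : Fin n → Fin n → Set} (π : ℕ → Fin n) → (∀ i → R (π i) (π (suc i))) →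
              ∀ d → Walk R (π 0) (π (suc d)) (applyUpTo π (suc d))
prefix-walk π moves zero    = edge (moves 0)
prefix-walk π moves (suc d) = step (moves 0) (prefix-walk (π ∘ suc) (moves ∘ suc) d)

module _ {n : ℕ} (G : Game n) where
  open Game G

  maxPr : List (Fin n) → ℕ
  maxPr vs = maxList (map pr vs)

  CyclesWonBy : (Fin n → Fin n → Set) → Player → Set
  CyclesWonBy R α = ∀ u vs → Walk R u u vs → parity (maxPr vs) ≡ α

  module Visits (π : ℕ → Fin n) {m} (inf : InfOften G π m) (k : ℕ) where

    visit : ℕ → ℕ
    visit zero    = proj₁ (inf k)
    visit (suc r) = proj₁ (inf (suc (visit r)))

    visit-pr : ∀ r → pr (π (visit r)) ≡ m
    visit-pr zero    = proj₂ (proj₂ (inf k))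
    visit-pr (suc r) = proj₂ (proj₂ (inf (suc (visit r))))

    visit-< : ∀ r → visit r < visit (suc r)
    visit-< r = proj₁ (proj₂ (inf (suc (visit r))))

    k≤visit : ∀ r → k ≤ visit r
    k≤visit zero    = proj₁ (proj₂ (inf k))
    k≤visit (suc r) = ≤-trans (k≤visit r) (<⇒≤ (visit-< r))

  -- n + 1 visits to priority m must repeat a vertex.
  infOften-loop : ∀ (π : ℕ → Fin n) {m} → InfOften G π m → ∀ k →
                  ∃₂ λ i d → k ≤ i × pr (π i) ≡ m × π (suc d + i) ≡ π i
  infOften-loop π inf k =
    let open Visits π inf k
        a , b , a<b , same = pigeonhole (n<1+n n) (λ r → π (visit (toℕ r)))
        d , gap = m≤n⇒∃[o]m+o≡n (increasing⇒monotone visit visit-< a<b)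
    in visit (toℕ a) , d , k≤visit (toℕ a) , visit-pr (toℕ a) ,
       trans (cong π (trans (cong suc (+-comm d (visit (toℕ a)))) gap)) (sym same)

  cycles-won⇒play-won : ∀ {R α} (π : ℕ → Fin n) → (∀ i → R (π i) (π (suc i))) →
                        CyclesWonBy R α → WonBy G α π
  cycles-won⇒play-won {R} {α} π moves won m inf (k , below)
    with i , d , k≤i , pr≡m , back ← infOften-loop π inf k
    = subst (λ q → parity q ≡ α) max≡m (won (π i) vs (subst (λ x → Walk R (π i) x vs) back loop))
    where
    ρ : ℕ → Fin n
    ρ t = π (t + i)
    vs : List (Fin n)
    vs = applyUpTo ρ (suc d)
    loop : Walk R (π i) (π (suc d + i)) vs
    loop = prefix-walk ρ (λ t → moves (t + i)) d
    max≡m : maxPr vs ≡ m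
    max≡m = maxList-map-≡ pr (applyUpTo⁺₂ ρ (suc d) λ t → below (t + i) (≤-trans k≤i (m≤n+m i t)))
                             (here pr≡m)

  IsMaxPr-unique : ∀ {C p q} → IsMaxPr G C p → IsMaxPr G C q → p ≡ q
  IsMaxPr-unique ((u , u∈C , pr≡p) , ≤p) ((v , v∈C , pr≡q) , ≤q) =
    ≤-antisym (subst (_≤ _) pr≡p (≤q u u∈C)) (subst (_≤ _) pr≡q (≤p v v∈C))

  IsTop-⊆ : ∀ {U p A} → IsTop G U p A → A ⊆ U
  IsTop-⊆ top x∈A = proj₁ (proj₁ (top _) x∈A)

  IsStrategyOn : Subset n → Player → Strategy n → Set
  IsStrategyOn Z α σ = ∀ {v w} → σ v ≡ just w → v ∈ Z × owner v ≡ α × E v w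

  IsStrategyOn-⊆ : ∀ {Z Z′ α σ} → Z ⊆ Z′ → IsStrategyOn Z α σ → IsStrategyOn Z′ α σ
  IsStrategyOn-⊆ Z⊆Z′ onZ eq = let v∈Z , ov , e = onZ eq in Z⊆Z′ v∈Z , ov , e

  IsStrategyOn-update : ∀ {Z α σ v w} → IsStrategyOn Z α σ →
                        v ∈ Z → owner v ≡ α → E v w → IsStrategyOn Z α (update σ v w)
  IsStrategyOn-update {σ = σ} {v} {w} onZ v∈Z ov e eq with update-just σ v w eq
  ... | inj₁ (refl , refl) = v∈Z , ov , e
  ... | inj₂ eq′           = onZ eq′

  IsStrategyOn-extend : ∀ {Z α σ τ} → IsStrategyOn Z α σ → IsStrategyOn Z α τ →
                        IsStrategyOn Z α (extend σ τ)
  IsStrategyOn-extend {σ = σ} {τ} onσ onτ eq with extend-just σ τ eq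
  ... | inj₁ eq′ = onσ eq′
  ... | inj₂ eq′ = onτ eq′

  witness-edge : ∀ {C α τ v w} → IsWitness G C α τ → τ v ≡ just w →
                 v ∈ C × owner v ≡ α × w ∈ C × E v w
  witness-edge (defined , domain) eq with domain _ _ eq
  ... | v∈C , ov with defined _ v∈C ov
  ...   | _ , eq′ , w∈C , e with just-injective (trans (sym eq) eq′)
  ...     | refl = v∈C , ov , w∈C , e

  WinningTangle : Tangle n → Player → Set
  WinningTangle t α = IsWitness G (carrier t) α (strat t) × CyclesWonBy (TGraph G (carrier t) α (strat t)) α

  SoundTangle : Tangle n → Set
  SoundTangle t = ∀ α → TangleOf G t α → WinningTangle t α

  tangle-sound : ∀ {t} → IsTangle G t → SoundTangle t
  tangle-sound (p , max , witness , _ , cycles) _ (q , max′ , refl) with IsMaxPr-unique max max′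
  ... | refl = witness , cycles

  Follows : Strategy n → Fin n → Fin n → Set
  Follows σ x y = ∀ w → σ x ≡ just w → y ≡ w

  Step : Subset n → Strategy n → Fin n → Fin n → Set
  Step U σ x y = y ∈ U × E x y × Follows σ x y

  Move : Subset n → Strategy n → Subset n → Fin n → Fin n → Set
  Move U σ Z x y = x ∈ Z × y ∈ Z × Step U σ x y

  Step-⊑ : ∀ {U σ σ′ x y} → σ ⊑ σ′ → Step U σ′ x y → Step U σ x y
  Step-⊑ σ⊑σ′ (y∈U , e , follows) = y∈U , e , λ w eq → follows w (σ⊑σ′ eq)

  -- Moves out of A are unconstrained: cycles through A are won because they contain the top priority.
  record IsRegion (U : Subset n) (α : Player) (A Z : Subset n) (σ : Strategy n) : Set where
    field
      Z⊆U    : Z ⊆ U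
      A⊆Z    : A ⊆ Z
      σ-on-Z : IsStrategyOn Z α σ
      closed : ∀ {x y} → x ∈ Z → x ∉ A → Step U σ x y → y ∈ Z
      cycles : ∀ u vs → Walk (Move U σ Z) u u vs → All (_∉ A) vs → parity (maxPr vs) ≡ α

    σ-undefined : ∀ {v} → v ∉ Z → σ v ≡ nothing
    σ-undefined {v} v∉Z with σ v in eq
    ... | nothing = refl
    ... | just _  = contradiction (proj₁ (σ-on-Z eq)) v∉Z

    cycles-inside : ∀ {σ′ Z′} → σ ⊑ σ′ → ∀ {u vs} → Walk (Move U σ′ Z′) u u vs →
                    All (_∉ A) vs → All (_∈ Z) vs → parity (maxPr vs) ≡ α
    cycles-inside {σ′} σ⊑σ′ w outside inside =
      cycles _ _ (Walk-restrict (λ (_ , _ , s) a∈Z b∈Z → a∈Z , b∈Z , Step-⊑ {σ′ = σ′} σ⊑σ′ s)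
                                w inside (Walk-head w inside))
             outside

  region-grow : ∀ {U α A Z σ Z′ σ′} → IsRegion U α A Z σ → Z ⊆ Z′ → Z′ ⊆ U → σ ⊑ σ′ →
                IsStrategyOn Z′ α σ′ → (∀ {x y} → x ∈ Z′ → x ∉ A → Step U σ′ x y → y ∈ Z) →
                IsRegion U α A Z′ σ′
  region-grow reg Z⊆Z′ Z′⊆U σ⊑σ′ on-Z′ land = record
    { Z⊆U    = Z′⊆U
    ; A⊆Z    = λ x∈A → Z⊆Z′ (A⊆Z x∈A)
    ; σ-on-Z = on-Z′
    ; closed = λ x∈Z′ x∉A s → Z⊆Z′ (land x∈Z′ x∉A s)
    ; cycles = λ _ _ w outside →
        cycles-inside σ⊑σ′ w outside
          (cycle-all (λ (a∈Z′ , _ , s) a∉A → land a∈Z′ a∉A s) w outside) }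
    where open IsRegion reg

  module Attractor (U : Subset n) (α : Player) (T : List (Tangle n)) (A : Subset n)
                   (A⊆U : A ⊆ U) (sound : All SoundTangle T) where

    region-init : IsRegion U α A A emptyStrat
    region-init = record
      { Z⊆U    = A⊆U
      ; A⊆Z    = id
      ; σ-on-Z = λ ()
      ; closed = λ x∈A x∉A _ → contradiction x∈A x∉A
      ; cycles = λ _ _ w outside → contradiction (Walk-head w (Walk-sources proj₁ w)) (Walk-head w outside) }

    region-attr-α : ∀ {Z σ v w} → IsRegion U α A Z σ → v ∈ U → v ∉ Z → owner v ≡ α → w ∈ Z → E v w →
                    IsRegion U α A (Z ∪ ⁅ v ⁆) (update σ v w)
    region-attr-α {Z} {σ} {v} {w} reg v∈U v∉Z ov w∈Z e =
      region-grow reg (p⊆p∪q _) (∪-⊆ Z⊆U (⁅⁆-⊆ v∈U)) σ⊑σ′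
        (IsStrategyOn-update (IsStrategyOn-⊆ (p⊆p∪q _) σ-on-Z) (q⊆p∪q Z _ (x∈⁅x⁆ v)) ov e) land
      where
      open IsRegion reg
      σ⊑σ′ : σ ⊑ update σ v w
      σ⊑σ′ = update-⊒ σ w (σ-undefined v∉Z)
      land : ∀ {x y} → x ∈ Z ∪ ⁅ v ⁆ → x ∉ A → Step U (update σ v w) x y → y ∈ Z
      land {x} x∈ x∉A s@(_ , _ , follows) with x∈p∪q⁻ Z ⁅ v ⁆ x∈
      ... | inj₁ x∈Z = closed x∈Z x∉A (Step-⊑ {σ′ = update σ v w} σ⊑σ′ s)
      ... | inj₂ x∈v with refl ← x∈⁅y⁆⇒x≡y v x∈v =
        subst (_∈ Z) (sym (follows w (update-≡ σ v w))) w∈Z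

    region-attr-ᾱ : ∀ {Z σ v} → IsRegion U α A Z σ → v ∈ U → (∀ w → w ∈ U → E v w → w ∈ Z) →
                    IsRegion U α A (Z ∪ ⁅ v ⁆) σ
    region-attr-ᾱ {Z} {σ} {v} reg v∈U succ⊆Z =
      region-grow reg (p⊆p∪q _) (∪-⊆ Z⊆U (⁅⁆-⊆ v∈U)) id (IsStrategyOn-⊆ (p⊆p∪q _) σ-on-Z) land
      where
      open IsRegion reg
      land : ∀ {x y} → x ∈ Z ∪ ⁅ v ⁆ → x ∉ A → Step U σ x y → y ∈ Z
      land x∈ x∉A s@(y∈U , e , _) with x∈p∪q⁻ Z ⁅ v ⁆ x∈
      ... | inj₁ x∈Z = closed x∈Z x∉A s
      ... | inj₂ x∈v with refl ← x∈⁅y⁆⇒x≡y v x∈v = succ⊆Z _ y∈U e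

    region-attr-A : ∀ {Z σ v w} → IsRegion U α A Z σ → v ∈ A → owner v ≡ α → σ v ≡ nothing → E v w →
                    IsRegion U α A Z (update σ v w)
    region-attr-A {Z} {σ} {v} {w} reg v∈A ov σv≡nothing e =
      region-grow reg id Z⊆U σ⊑σ′ (IsStrategyOn-update σ-on-Z (A⊆Z v∈A) ov e)
        λ x∈Z x∉A s → closed x∈Z x∉A (Step-⊑ {σ′ = update σ v w} σ⊑σ′ s)
      where
      open IsRegion reg
      σ⊑σ′ : σ ⊑ update σ v w
      σ⊑σ′ = update-⊒ σ w σv≡nothing

    module TangleStep {Z σ} (t : Tangle n) (t∈T : t L.∈ T) (C⊆U : carrier t ⊆ U) (of-α : TangleOf G t α)
                      (escapes-to-Z : ∀ v → ETEdge G U t α v → v ∈ Z) (reg : IsRegion U α A Z σ) where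
      open IsRegion reg

      C : Subset n
      C = carrier t

      τ σ′ : Strategy n
      τ  = strat t
      σ′ = extend σ τ

      σ⊑σ′ : σ ⊑ σ′
      σ⊑σ′ = extend-⊒ σ τ

      winning : WinningTangle t α
      winning = All.lookup sound t∈T α of-α

      τ-move : ∀ {x y} → x ∈ C → x ∉ Z → owner x ≡ α → Follows σ′ x y → τ x ≡ just y × y ∈ C
      τ-move {x} x∈C x∉Z ox follows with proj₁ (proj₁ winning) x x∈C ox
      ... | w , τx≡w , w∈C , _
          with refl ← follows w (trans (extend-nothing σ τ (σ-undefined x∉Z)) τx≡w) =
        τx≡w , w∈C

      closed′ : ∀ {x y} → x ∈ Z ∪ C → x ∉ A → Step U σ′ x y → y ∈ Z ∪ C
      closed′ {x} {y} x∈ x∉A s@(y∈U , e , follows) with x ∈? Z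
      ... | yes x∈Z = p⊆p∪q _ (closed x∈Z x∉A (Step-⊑ {σ′ = σ′} σ⊑σ′ s))
      ... | no x∉Z with ≡-or-opp (owner x) α
      ...   | inj₁ ox = q⊆p∪q Z C (proj₂ (τ-move (∈-∪-∉ x∈ x∉Z) x∉Z ox follows))
      ...   | inj₂ ox with y ∈? C
      ...     | yes y∈C = q⊆p∪q Z C y∈C
      ...     | no y∉C  = p⊆p∪q _ (escapes-to-Z y (y∈U , y∉C , x , ∈-∪-∉ x∈ x∉Z , ox , e))

      tangle-edge : ∀ {a b} → Move U σ′ (Z ∪ C) a b → a ∈ C × a ∉ Z → b ∈ C × b ∉ Z →
                    TGraph G C α τ a b
      tangle-edge (_ , _ , _ , e , follows) (a∈C , a∉Z) (b∈C , _) =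
        a∈C , b∈C , e , λ oa → proj₁ (τ-move a∈C a∉Z oa follows)

      -- A cycle meeting Z stays in Z; otherwise it lies in C ∖ Z, where σ′ follows the tangle.
      cycles′ : ∀ u vs → Walk (Move U σ′ (Z ∪ C)) u u vs → All (_∉ A) vs → parity (maxPr vs) ≡ α
      cycles′ u vs w outside with any? (_∈? Z) vs
      ... | yes meets-Z =
        cycles-inside σ⊑σ′ w outside
          (cycle-spread (λ (_ , _ , s) a∉A a∈Z → closed a∈Z a∉A (Step-⊑ {σ′ = σ′} σ⊑σ′ s))
                        w outside meets-Z)
      ... | no avoids-Z = proj₂ winning u vs (Walk-restrict tangle-edge w in-C∖Z (Walk-head w in-C∖Z))
        where
        in-C∖Z : All (λ x → x ∈ C × x ∉ Z) vs
        in-C∖Z = All.zipWith (λ (x∈ , x∉Z) → ∈-∪-∉ x∈ x∉Z , x∉Z)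
                             (Walk-sources proj₁ w , ¬Any⇒All¬ vs avoids-Z)

      region : IsRegion U α A (Z ∪ C) σ′
      region = record
        { Z⊆U    = ∪-⊆ Z⊆U C⊆U
        ; A⊆Z    = λ x∈A → p⊆p∪q _ (A⊆Z x∈A)
        ; σ-on-Z = IsStrategyOn-extend (IsStrategyOn-⊆ (p⊆p∪q _) σ-on-Z)
                                       (λ eq → let x∈C , ox , _ , e = witness-edge (proj₁ winning) eq
                                               in q⊆p∪q Z C x∈C , ox , e)
        ; closed = closed′
        ; cycles = cycles′ }

    AttrRegion : AttrState G → Set
    AttrRegion (Z , σ) = IsRegion U α A Z σ

    region-step : ∀ {s s′} → AttrStep G U α T A s s′ → AttrRegion s → AttrRegion s′
    region-step (attrα v∈U v∉Z ov _ w∈Z e)            reg = region-attr-α reg v∈U v∉Z ov w∈Z e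
    region-step (attrᾱ v∈U _ _ succ⊆Z)               reg = region-attr-ᾱ reg v∈U succ⊆Z
    region-step (attrA v∈A ov σv≡nothing _ _ e)       reg = region-attr-A reg v∈A ov σv≡nothing e
    region-step (attrT t t∈T C⊆U of-α _ escapes _)    reg = TangleStep.region t t∈T C⊆U of-α escapes reg

  attractor-region : ∀ {U α T A Z σ} → A ⊆ U → All SoundTangle T →
                     Star (AttrStep G U α T A) (A , emptyStrat) (Z , σ) → IsRegion U α A Z σ
  attractor-region {U} {α} {T} {A} A⊆U sound run =
    fold (λ s s′ → AttrRegion s → AttrRegion s′) (λ st k → k ∘ region-step st) id run region-init
    where open Attractor U α T A A⊆U sound

  region-cycles-won : ∀ {U p A Z σ} → IsMaxPr G U p → IsTop G U p A → IsRegion U (parity p) A Z σ →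
                      CyclesWonBy (Move U σ Z) (parity p)
  region-cycles-won {A = A} max top reg u vs w with any? (_∈? A) vs
  ... | no avoids-A = IsRegion.cycles reg u vs w (¬Any⇒All¬ vs avoids-A)
  ... | yes meets-A =
    cong parity (maxList-map-≡ pr bounded (Any.map (λ x∈A → proj₂ (proj₁ (top _) x∈A)) meets-A))
    where
    bounded : All (λ x → pr x ≤ _) vs
    bounded = All.map (λ x∈Z → proj₂ max _ (IsRegion.Z⊆U reg x∈Z)) (Walk-sources proj₁ w)

  module Extracted {U α A Z σ X} (reg : IsRegion U α A Z σ) (won : CyclesWonBy (Move U σ Z) α)
                   (X-fix : IsXFix G U α Z σ X) {t : Tangle n}
                   (scc : IsNBSCC G U α σ X (carrier t))
                   (τ≡ : ∀ v → strat t v ≡ restrict σ (carrier t) v) where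
    open IsRegion reg

    C : Subset n
    C = carrier t

    C⊆X : C ⊆ X
    C⊆X = proj₁ scc

    X⊆Z : X ⊆ Z
    X⊆Z x∈X = proj₁ (proj₁ (X-fix _) x∈X)

    C-bottom : ∀ {u w} → u ∈ C → Star (XGraph G U α σ X) u w → w ∈ C
    C-bottom = proj₁ (proj₂ (proj₂ scc)) _ _

    XGraph⇒Move : ∀ {x y} → XGraph G U α σ X x y → Move U σ Z x y
    XGraph⇒Move (x∈X , y∈X , inj₁ (ox , y∈U , e)) =
      X⊆Z x∈X , X⊆Z y∈X , y∈U , e ,
      λ w eq → ⊥-elim (opp-≢ α (trans (sym ox) (proj₁ (proj₂ (σ-on-Z eq)))))
    XGraph⇒Move (x∈X , y∈X , inj₂ (_ , eq)) =
      X⊆Z x∈X , X⊆Z y∈X , Z⊆U (X⊆Z y∈X) , proj₂ (proj₂ (σ-on-Z eq)) ,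
      λ w eq′ → just-injective (trans (sym eq) eq′)

    C-cycle : ∀ {u} → u ∈ C → ∃ λ vs → Walk (XGraph G U α σ X) u u (u ∷ vs)
    C-cycle {u} u∈C =
      let _ , strong , _ , a , b , a∈C , b∈C , ab = scc
      in Walk-via (strong u a u∈C a∈C) ab (strong b u b∈C u∈C)

    parity-C : ∀ {p} → IsMaxPr G C p → parity p ≡ α
    parity-C {p} ((u , u∈C , pr≡p) , ≤p) with vs , loop ← C-cycle u∈C =
      subst (λ q → parity q ≡ α) max≡p (won u (u ∷ vs) (Walk-map XGraph⇒Move loop))
      where
      max≡p : maxPr (u ∷ vs) ≡ p
      max≡p = maxList-map-≡ pr (All.map (λ reach → ≤p _ (C-bottom u∈C reach)) (Walk-reachable loop))
                               (here pr≡p)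

    witness : IsWitness G C α (strat t)
    witness = defined , domain
      where
      defined : ∀ v → v ∈ C → owner v ≡ α → ∃ λ w → strat t v ≡ just w × w ∈ C × E v w
      defined v v∈C ov with proj₂ (proj₁ (X-fix v) (C⊆X v∈C))
      ... | inj₁ (ov′ , _) = ⊥-elim (opp-≢ α (trans (sym ov′) ov))
      ... | inj₂ (_ , w , σv≡w , w∈X) =
        w , trans (τ≡ v) (trans (restrict-∈ σ v∈C) σv≡w) ,
        C-bottom v∈C ((C⊆X v∈C , w∈X , inj₂ (ov , σv≡w)) ◅ ε) , proj₂ (proj₂ (σ-on-Z σv≡w))
      domain : ∀ v w → strat t v ≡ just w → v ∈ C × owner v ≡ α
      domain v w eq = let v∈C , σv≡w = restrict-just σ C (trans (sym (τ≡ v)) eq)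
                      in v∈C , proj₁ (proj₂ (σ-on-Z σv≡w))

    TGraph⇒Move : ∀ {x y} → TGraph G C α (strat t) x y → Move U σ Z x y
    TGraph⇒Move {x} (x∈C , y∈C , e , τ-follows) =
      X⊆Z (C⊆X x∈C) , X⊆Z (C⊆X y∈C) , Z⊆U (X⊆Z (C⊆X y∈C)) , e ,
      λ w σx≡w → just-injective (trans (sym (τ-follows (proj₁ (proj₂ (σ-on-Z σx≡w)))))
                                       (trans (τ≡ x) (trans (restrict-∈ σ x∈C) σx≡w)))

    sound : SoundTangle t
    sound _ (p , max , refl) =
      subst (WinningTangle t) (sym (parity-C max)) (witness , λ u vs w → won u vs (Walk-map TGraph⇒Move w))

  extracted-sound : ∀ {U α A Z σ As} → IsRegion U α A Z σ → CyclesWonBy (Move U σ Z) α →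
                    ExtractSpec G U α Z σ As → All SoundTangle As
  extracted-sound reg won (_ , (X-fix , _) , extracted , _) =
    All.tabulate λ t∈As → let scc , τ≡ = extracted _ t∈As in Extracted.sound reg won X-fix scc τ≡

  SoundConfig : Config G → Set
  SoundConfig (T , _ , Y) = All SoundTangle T × All SoundTangle Y

  search-step : ∀ {c c′} → SearchStep G c c′ → SoundConfig c → SoundConfig c′
  search-step (inner {_} {D} {_} {p} {A} {Z} {σ} _ max top (run , _) extract _) (sound-T , sound-Y) =
    sound-T , ++⁺ sound-Y (extracted-sound reg (region-cycles-won max top reg) extract)
    where
    reg : IsRegion (∁ D) (parity p) A Z σ
    reg = attractor-region (IsTop-⊆ top) sound-T run
  search-step (outer _) (sound-T , sound-Y) = ++⁺ sound-T sound-Y , []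

  search-sound : ∀ {c c′} → Star (SearchStep G) c c′ → SoundConfig c → SoundConfig c′
  search-sound = fold (λ c c′ → SoundConfig c → SoundConfig c′) (λ st k → k ∘ search-step st) id

lemma2 : ∀ {n} (G : Game n) (T₀ : List (Tangle n)) →
    (∀ t → t L.∈ T₀ → IsTangle G t) →
    ∀ {T D Y} → Star (SearchStep G) (T₀ , ⊥ , []) (T , D , Y) →
    Nonempty (∁ D) →
    ∀ p A Z σ → IsMaxPr G (∁ D) p → IsTop G (∁ D) p A →
    AttrComp G (∁ D) (parity p) T A Z σ →
    ∀ (π : ℕ → Fin n) → IsPlay G (∁ D) π → Consistent G σ π → (∀ i → π i ∈ Z) →
    WonBy G (parity p) π
lemma2 G T₀ tangles {T} {D} run _ p A Z σ max top (attr , _) π play consistent in-Z =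
  cycles-won⇒play-won G π moves (region-cycles-won G max top region)
  where
  sound-T : All (SoundTangle G) T
  sound-T = proj₁ (search-sound G run (All.tabulate (λ t∈ → tangle-sound G (tangles _ t∈)) , []))
  region : IsRegion G (∁ D) (parity p) A Z σ
  region = attractor-region G (IsTop-⊆ G top) sound-T attr
  moves : ∀ i → Move G (∁ D) σ Z (π i) (π (suc i))
  moves i = in-Z i , in-Z (suc i) , proj₁ (play (suc i)) , proj₂ (play i) , consistent i
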